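{- For every real $R\ge 1$, there is no constant competitive deterministic online algorithm for the general\&non-removable online knapsack problem with a buffer of capacity $R$; that is, for every deterministic online algorithm $\mathrm{ALG}$ and every real $c$, there is an input sequence $I$ with $\mathrm{OPT}(I)> c\cdot\mathrm{ALG}(I)$.
   Context: Online knapsack problem with a resource buffer: there is a knapsack of capacity $1$ and a buffer of capacity $R\ge 1$. Items $e_1,\dots,e_n$ arrive one by one; each item $e$ has size $s(e)$ with $0<s(e)\le 1$ and value $v(e)\ge 0$; for a set $B$ write $s(B)=\sum_{e\in B}s(e)$, $v(B)=\sum_{e\in B}v(e)$. A deterministic online algorithm maintains buffer contents $B_0=\emptyset,B_1,\dots,B_n$, where $B_i$ is chosen after seeing $e_1,\dots,e_i$ (without knowledge of future items), with $B_i\subseteq B_{i-1}\cup\{e_i\}$ and $s(B_i)\le R$. In the non-removable setting additionally $B_{i-1}\subseteq B_i$. The algorithm's value is $\mathrm{ALG}(I)=\max\{v(B)\mid B\subseteq B_n,\ s(B)\le 1\}$ and $\mathrm{OPT}(I)=\max\{v(B)\mid B\subseteq\{e_1,\dots,e_n\},\ s(B)\le 1\}$. "General" means values are arbitrary. An algorithm is $c$-competitive if $\mathrm{OPT}(I)\le c\cdot \mathrm{ALG}(I)$ for every input $I$.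
   Formalization: The buffer capacity R and the constant c range over ℚ rather than the reals, and the item sizes and values of the input sequence are taken in ℚ. -}

module Defs where

open import Data.Bool using (Bool; true; false; if_then_else_)
open import Data.List using (List; []; _∷_; _++_; [_]; map; foldr; filter)
open import Data.List.Relation.Unary.All using (All)
open import Data.Product using (_×_; _,_; proj₁; proj₂)
open import Data.Rational using (ℚ; 0ℚ; 1ℚ; _+_; _≤_; _<_; _⊔_; _≤?_)

Item : Set
Item = ℚ × ℚ

size : Item → ℚ
size = proj₁

value : Item → ℚ
value = proj₂

sizeOf : List Item → ℚ
sizeOf = foldr (λ e acc → size e + acc) 0ℚ

valueOf : List Item → ℚ
valueOf = foldr (λ e acc → value e + acc) 0ℚ

ValidItem : Item → Set
ValidItem e = (0ℚ < size e) × (size e ≤ 1ℚ) × (0ℚ ≤ value e)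

ValidInput : List Item → Set
ValidInput = All ValidItem

sublists : {A : Set} → List A → List (List A)
sublists [] = [] ∷ []
sublists (x ∷ xs) = let r = sublists xs in map (x ∷_) r ++ r

maximum0 : List ℚ → ℚ
maximum0 = foldr _⊔_ 0ℚ

-- max { v(B) | B ⊆ S, s(B) ≤ 1 }   (the empty set is always allowed, value 0)
bestPacking : List Item → ℚ
bestPacking S = maximum0 (map valueOf (filter (λ B → sizeOf B ≤? 1ℚ) (sublists S)))

OPT : List Item → ℚ
OPT = bestPacking

-- A deterministic online algorithm in the non-removable setting: when item e_i
-- arrives, having seen e_1,…,e_{i-1} (the history), it decides whether to add e_i
-- to the buffer (B_i = B_{i-1} ∪ {e_i}) or not (B_i = B_{i-1}).  Since it is
-- deterministic, its previous buffers are functions of the history.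
Decision : Set
Decision = List Item → Item → Bool

runFrom : Decision → List Item → List Item → List Item
runFrom d hist [] = []
runFrom d hist (e ∷ es) =
  (if d hist e then e ∷ [] else []) ++ runFrom d (hist ++ [ e ]) es

run : Decision → List Item → List Item
run d = runFrom d []

-- A (legal) algorithm for buffer capacity R: the buffer never exceeds R on any
-- valid input (buffers only grow, so checking every complete input suffices,
-- every prefix of a valid input being itself a valid input).
record OnlineAlg (R : ℚ) : Set where
  field
    decide : Decision
    fits   : ∀ I → ValidInput I → sizeOf (run decide I) ≤ R

ALG : {R : ℚ} → OnlineAlg R → List Item → ℚ
ALG A I = bestPacking (run (OnlineAlg.decide A) I)

module Submission where

-- The adversary offers items of size 1 whose value is 1 more than K times the
-- total value offered so far, K = max c 0.  Accepting n items needs a buffer of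
-- size n, so an algorithm with finite R must reject some item; stop the input
-- right there.  The buffer then holds at most the value V of the earlier items,
-- while OPT can pack the rejected item alone, worth K V + 1 > c V.

open import Defs
open import Data.Product using (Σ; _×_; _,_; proj₂; ∃)
open import Data.List using (List; []; _∷_; _++_; [_]; map; filter)
open import Data.Rational
  using (ℚ; 0ℚ; 1ℚ; _≤_; _<_; _+_; _*_; _⊔_; _≤?_; mkℚ; *<*; nonNegative)
open import Data.Rational.Properties
open import Data.Rational.Literals using (fromℤ)
import Data.Rational.Unnormalised as ℚᵘ
import Data.Rational.Unnormalised.Properties as ℚᵘ
open import Data.Integer as ℤ using (+_; -[1+_]; +<+; -<+)
import Data.Integer.Properties as ℤ
open import Data.Integer.Tactic.RingSolver using (solve-∀)
open import Data.Nat as ℕ using (ℕ; zero; suc)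
import Data.Nat.Properties as ℕ
open import Data.Bool using (true; false; if_then_else_)
open import Data.Sum using (_⊎_; inj₁; inj₂)
open import Data.Empty using (⊥-elim)
open import Function using (_∘_)
open import Data.List.Properties
  using (++-assoc; ++-identityʳ; foldr-preservesᵇ; foldr-preservesᵒ)
open import Data.List.Relation.Unary.All as All using (All; []; _∷_)
import Data.List.Relation.Unary.All.Properties as All
import Data.List.Relation.Unary.Any as Any
open import Data.List.Relation.Unary.Any using (here)
open import Data.List.Membership.Propositional using (_∈_)
open import Data.List.Membership.Propositional.Properties
  using (∈-map⁺; ∈-map⁻; ∈-filter⁺; ∈-++⁺ˡ; ∈-++⁺ʳ; ∈-++⁻)
open import Data.List.Relation.Binary.Sublist.Propositional
  using (_⊆_; []; _∷_; _∷ʳ_; ⊆-refl)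
open import Data.List.Relation.Binary.Sublist.Propositional.Properties
  using (All-resp-⊆; []⊆-universal; ++⁺ˡ)
open import Relation.Binary.PropositionalEquality
  using (_≡_; refl; sym; trans; cong; subst; module ≡-Reasoning)

p≤q+p : ∀ {p q} → 0ℚ ≤ q → p ≤ q + p
p≤q+p {p} {q} 0≤q = subst (_≤ q + p) (+-identityˡ p) (+-monoˡ-≤ p 0≤q)

fromℤ-suc : ∀ n → fromℤ (+ n) + 1ℚ ≡ fromℤ (+ suc n)
fromℤ-suc n = toℚᵘ-injective
  (ℚᵘ.≃-trans (toℚᵘ-homo-+ (fromℤ (+ n)) 1ℚ) (ℚᵘ.*≡* (cross-multiplied (+ n))))
  where
  cross-multiplied : ∀ x → (x ℤ.* + 1 ℤ.+ + 1 ℤ.* + 1) ℤ.* + 1 ≡ (+ 1 ℤ.+ x) ℤ.* + 1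
  cross-multiplied = solve-∀

archimedean : ∀ p → ∃ λ n → p < fromℤ (+ n)
archimedean (mkℚ (+ n) d _) = suc n , *<* (subst (ℤ._< + suc n ℤ.* + suc d)
  (sym (ℤ.*-identityʳ (+ n))) (+<+ (ℕ.m≤m*n (suc n) (suc d))))
archimedean (mkℚ -[1+ n ] d _) = 0 , *<* -<+

⊔-upper : ∀ {v} p q → v ≤ p ⊎ v ≤ q → v ≤ p ⊔ q
⊔-upper p q (inj₁ v≤p) = p≤q⇒p≤q⊔r q v≤p
⊔-upper p q (inj₂ v≤q) = p≤q⇒p≤r⊔q p v≤q

maximum0-nonneg : ∀ xs → 0ℚ ≤ maximum0 xs
maximum0-nonneg xs = foldr-preservesᵒ ⊔-upper 0ℚ xs (inj₁ ≤-refl)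

∈⇒≤maximum0 : ∀ {x xs} → x ∈ xs → x ≤ maximum0 xs
∈⇒≤maximum0 {xs = xs} x∈xs = foldr-preservesᵒ ⊔-upper 0ℚ xs (inj₂ (Any.map ≤-reflexive x∈xs))

maximum0-lub : ∀ {M xs} → 0ℚ ≤ M → All (_≤ M) xs → maximum0 xs ≤ M
maximum0-lub = foldr-preservesᵇ ⊔-lub

⊆⇒∈-sublists : ∀ {A : Set} {xs ys : List A} → xs ⊆ ys → xs ∈ sublists ys
⊆⇒∈-sublists [] = here refl
⊆⇒∈-sublists (y ∷ʳ τ) = ∈-++⁺ʳ (map (y ∷_) _) (⊆⇒∈-sublists τ)
⊆⇒∈-sublists (refl ∷ τ) = ∈-++⁺ˡ (∈-map⁺ (_ ∷_) (⊆⇒∈-sublists τ))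

∈-sublists⇒⊆ : ∀ {A : Set} {xs : List A} ys → xs ∈ sublists ys → xs ⊆ ys
∈-sublists⇒⊆ [] (here refl) = []
∈-sublists⇒⊆ (y ∷ ys) xs∈ with ∈-++⁻ (map (y ∷_) (sublists ys)) xs∈
... | inj₂ xs∈′ = y ∷ʳ ∈-sublists⇒⊆ ys xs∈′
... | inj₁ yxs∈ with ∈-map⁻ (y ∷_) yxs∈
...   | _ , zs∈ , refl = refl ∷ ∈-sublists⇒⊆ ys zs∈

sizeOf-++ : ∀ xs ys → sizeOf (xs ++ ys) ≡ sizeOf xs + sizeOf ys
sizeOf-++ [] ys = sym (+-identityˡ (sizeOf ys))
sizeOf-++ (x ∷ xs) ys =
  trans (cong (_+_ (size x)) (sizeOf-++ xs ys)) (sym (+-assoc (size x) (sizeOf xs) (sizeOf ys)))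

NonNegValues : List Item → Set
NonNegValues = All (λ e → 0ℚ ≤ value e)

valid⇒nonNegValues : ∀ {I} → ValidInput I → NonNegValues I
valid⇒nonNegValues = All.map (proj₂ ∘ proj₂)

valueOf-mono-⊆ : ∀ {xs ys} → NonNegValues ys → xs ⊆ ys → valueOf xs ≤ valueOf ys
valueOf-mono-⊆ [] [] = ≤-refl
valueOf-mono-⊆ (0≤y ∷ nn) (y ∷ʳ τ) = ≤-trans (valueOf-mono-⊆ nn τ) (p≤q+p 0≤y)
valueOf-mono-⊆ (_ ∷ nn) (_∷_ {x = x} refl τ) = +-monoʳ-≤ (value x) (valueOf-mono-⊆ nn τ)

valueOf-nonneg : ∀ {xs} → NonNegValues xs → 0ℚ ≤ valueOf xs
valueOf-nonneg nn = valueOf-mono-⊆ nn ([]⊆-universal _)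

bestPacking-nonneg : ∀ S → 0ℚ ≤ bestPacking S
bestPacking-nonneg S =
  maximum0-nonneg (map valueOf (filter (λ B → sizeOf B ≤? 1ℚ) (sublists S)))

bestPacking-≤-valueOf : ∀ {S} → NonNegValues S → bestPacking S ≤ valueOf S
bestPacking-≤-valueOf {S} nn = maximum0-lub (valueOf-nonneg nn)
  (All.map⁺ (All.filter⁺ _ (All.tabulate (valueOf-mono-⊆ nn ∘ ∈-sublists⇒⊆ S))))

⊆⇒valueOf≤bestPacking : ∀ {B S} → B ⊆ S → sizeOf B ≤ 1ℚ → valueOf B ≤ bestPacking S
⊆⇒valueOf≤bestPacking B⊆S fits =
  ∈⇒≤maximum0 (∈-map⁺ valueOf (∈-filter⁺ (λ B → sizeOf B ≤? 1ℚ) (⊆⇒∈-sublists B⊆S) fits))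

runFrom-⊆ : ∀ d hist xs → runFrom d hist xs ⊆ xs
runFrom-⊆ d hist [] = []
runFrom-⊆ d hist (x ∷ xs) with d hist x
... | true = refl ∷ runFrom-⊆ d (hist ++ [ x ]) xs
... | false = x ∷ʳ runFrom-⊆ d (hist ++ [ x ]) xs

runFrom-++ : ∀ d hist xs ys →
  runFrom d hist (xs ++ ys) ≡ runFrom d hist xs ++ runFrom d (hist ++ xs) ys
runFrom-++ d hist [] ys = cong (λ h → runFrom d h ys) (sym (++-identityʳ hist))
runFrom-++ d hist (x ∷ xs) ys
  rewrite runFrom-++ d (hist ++ [ x ]) xs ys | ++-assoc hist [ x ] xs
  = sym (++-assoc (if d hist x then [ x ] else []) (runFrom d (hist ++ [ x ]) xs) _)

run-snoc : ∀ d xs x → run d (xs ++ [ x ]) ≡ run d xs ++ (if d xs x then [ x ] else [])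
run-snoc d xs x = trans (runFrom-++ d [] xs [ x ]) (cong (run d xs ++_) (++-identityʳ _))

run-snoc-accept : ∀ d xs x → d xs x ≡ true → run d (xs ++ [ x ]) ≡ run d xs ++ [ x ]
run-snoc-accept d xs x accept =
  trans (run-snoc d xs x) (cong (λ b → run d xs ++ (if b then [ x ] else [])) accept)

run-snoc-reject : ∀ d xs x → d xs x ≡ false → run d (xs ++ [ x ]) ≡ run d xs
run-snoc-reject d xs x reject =
  trans (run-snoc d xs x)
    (trans (cong (λ b → run d xs ++ (if b then [ x ] else [])) reject) (++-identityʳ _))

module Adversary (K : ℚ) (0≤K : 0ℚ ≤ K) where

  nextItem : List Item → Item
  nextItem hist = 1ℚ , K * valueOf hist + 1ℚ

  0≤K*p : ∀ {p} → 0ℚ ≤ p → 0ℚ ≤ K * p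
  0≤K*p {p} 0≤p = subst (_≤ K * p) (*-zeroʳ K) (*-monoˡ-≤-nonNeg K {{nonNegative 0≤K}} 0≤p)

  adversary : ℕ → List Item
  adversary zero = []
  adversary (suc n) = adversary n ++ [ nextItem (adversary n) ]

  adversary-valid : ∀ n → ValidInput (adversary n)
  adversary-valid zero = []
  adversary-valid (suc n) =
    All.++⁺ (adversary-valid n) ((positive⁻¹ 1ℚ , ≤-refl , 0≤value) ∷ [])
    where
    0≤value : 0ℚ ≤ K * valueOf (adversary n) + 1ℚ
    0≤value = +-mono-≤ (0≤K*p (valueOf-nonneg (valid⇒nonNegValues (adversary-valid n))))
                       (nonNegative⁻¹ 1ℚ)

  sizeOf-adversary : ∀ n → sizeOf (adversary n) ≡ fromℤ (+ n)
  sizeOf-adversary zero = refl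
  sizeOf-adversary (suc n) = begin
    sizeOf (adversary n ++ [ nextItem (adversary n) ]) ≡⟨ sizeOf-++ (adversary n) _ ⟩
    sizeOf (adversary n) + 1ℚ                          ≡⟨ cong (_+ 1ℚ) (sizeOf-adversary n) ⟩
    fromℤ (+ n) + 1ℚ                                   ≡⟨ fromℤ-suc n ⟩
    fromℤ (+ suc n)                                    ∎
    where open ≡-Reasoning

  Rejects : Decision → ℕ → Set
  Rejects d k = d (adversary k) (nextItem (adversary k)) ≡ false

  rejects-or-acceptsAll : ∀ d n → (∃ λ k → Rejects d k) ⊎ run d (adversary n) ≡ adversary n
  rejects-or-acceptsAll d zero = inj₂ refl
  rejects-or-acceptsAll d (suc n) with rejects-or-acceptsAll d n
  ... | inj₁ rejection = inj₁ rejection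
  ... | inj₂ acceptsAll with d (adversary n) (nextItem (adversary n)) in decision
  ...   | false = inj₁ (n , decision)
  ...   | true = inj₂ (trans (run-snoc-accept d _ _ decision)
                             (cong (_++ [ nextItem (adversary n) ]) acceptsAll))

  beaten-after-rejection : ∀ d k → Rejects d k →
    K * bestPacking (run d (adversary (suc k))) < OPT (adversary (suc k))
  beaten-after-rejection d k rejection = begin-strict
    K * bestPacking (run d (xs ++ [ e ])) ≤⟨ *-monoˡ-≤-nonNeg K {{nonNegative 0≤K}} alg≤V ⟩
    K * valueOf xs                        ≡⟨ +-identityʳ _ ⟨
    K * valueOf xs + 0ℚ                   <⟨ +-monoʳ-< (K * valueOf xs) (positive⁻¹ 1ℚ) ⟩
    K * valueOf xs + 1ℚ                   ≡⟨ +-identityʳ _ ⟨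
    valueOf [ e ]                         ≤⟨ ⊆⇒valueOf≤bestPacking (++⁺ˡ xs ⊆-refl) ≤-refl ⟩
    OPT (xs ++ [ e ])                     ∎
    where
    open ≤-Reasoning
    xs = adversary k
    e = nextItem xs
    nn : NonNegValues xs
    nn = valid⇒nonNegValues (adversary-valid k)
    buffer⊆xs : run d (xs ++ [ e ]) ⊆ xs
    buffer⊆xs = subst (_⊆ xs) (sym (run-snoc-reject d xs e rejection)) (runFrom-⊆ d [] xs)
    alg≤V : bestPacking (run d (xs ++ [ e ])) ≤ valueOf xs
    alg≤V = ≤-trans (bestPacking-≤-valueOf (All-resp-⊆ buffer⊆xs nn))
                    (valueOf-mono-⊆ nn buffer⊆xs)

  unbounded-ratio : ∀ {R} (A : OnlineAlg R) →
    Σ (List Item) λ I → ValidInput I × K * ALG A I < OPT I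
  unbounded-ratio {R} A with archimedean R
  ... | N , R<N with rejects-or-acceptsAll (OnlineAlg.decide A) N
  ...   | inj₁ (k , rejection) =
          adversary (suc k) , adversary-valid (suc k) , beaten-after-rejection _ k rejection
  ...   | inj₂ acceptsAll = ⊥-elim (<-irrefl refl (<-≤-trans R<N N≤R))
    where
    N≤R : fromℤ (+ N) ≤ R
    N≤R = subst (_≤ R) (trans (cong sizeOf acceptsAll) (sizeOf-adversary N))
                (OnlineAlg.fits A (adversary N) (adversary-valid N))

theorem1 : (R : ℚ) → 1ℚ ≤ R → (A : OnlineAlg R) → (c : ℚ) →
    Σ (List Item) (λ I → ValidInput I × (c * ALG A I < OPT I))
theorem1 R _ A c with Adversary.unbounded-ratio (c ⊔ 0ℚ) (p≤q⊔p c 0ℚ) A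
... | I , valid , K*alg<opt = I , valid , ≤-<-trans c*alg≤K*alg K*alg<opt
  where
  c*alg≤K*alg : c * ALG A I ≤ (c ⊔ 0ℚ) * ALG A I
  c*alg≤K*alg = *-monoʳ-≤-nonNeg (ALG A I)
    {{nonNegative (bestPacking-nonneg (run (OnlineAlg.decide A) I))}} (p≤p⊔q c 0ℚ)
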